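{- Let $FX=1+\mathbb{A}\times X+[\mathbb{A}]X$ and $GX=2\times X^{\mathbb{A}}\times[\mathbb{A}]X$ on $\mathsf{Nom}$, and let $T=\mathcal{P}_{\mathsf{ufs}}$ with unit $\eta$ and multiplication $\mu$. Define natural transformations: $\varepsilon\colon TF\to GT$ by $\varepsilon_X(S)=(b,\,a\mapsto\{x:(a,x)\in S\},\,\langle d\rangle\{x:\langle d\rangle x\in S\})$ with $b=1$ iff $\ast\in S$ and $d$ fresh for $S$; $\lambda\colon FT\to TF$ by $\lambda_X(\ast)=\{\ast\}$, $\lambda_X(a,S)=\{(a,x):x\in S\}$, $\lambda_X(\langle a\rangle S)=\{\langle a\rangle x:x\in S\}$; and $\rho\colon TG\to GT$ by $\rho_X(S)=(b,\,a\mapsto\{f(a):f\in p_1[S]\},\,\langle d\rangle\{x:\langle d\rangle x\in p_2[S]\})$ with $b=1$ iff $1\in p_0[S]$ and $d$ fresh for $S$, where $p_0,p_1,p_2$ are the product projections of $2\times X^{\mathbb{A}}\times[\mathbb{A}]X$. Then $\varepsilon$ is an extension natural transformation, i.e. $\varepsilon\cdot\mu F\cdot T\lambda=G\mu\cdot\varepsilon T$ and $\varepsilon\cdot\mu F=G\mu\cdot\rho T\cdot T\varepsilon$.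
   Context: Fix a countably infinite set $\mathbb{A}$ of names; a nominal set is a set with an action of the finite permutations of $\mathbb{A}$ in which every element $x$ has a finite support with least support $\mathrm{supp}(x)$; $d$ is fresh for $x$ if $d\notin\mathrm{supp}(x)$; $\mathsf{Nom}$ is the category of nominal sets and equivariant maps; $X^{\mathbb{A}}$ is the exponential; $1=\{\ast\}$, $2=\{0,1\}$. $\mathcal{P}_{\mathsf{ufs}}X$ is the nominal set of uniformly finitely supported subsets ($S$ with $\bigcup_{x\in S}\mathrm{supp}(x)$ finite), a monad with $\eta_X(x)=\{x\}$, $\mu_X$ = union, and action on maps by direct image. $[\mathbb{A}]X$ is the quotient of $\mathbb{A}\times X$ by $(a,x)\sim(b,y)$ iff $(a\,e)\cdot x=(b\,e)\cdot y$ for some (equivalently all) fresh $e$, classes written $\langle a\rangle x$. ($\lambda$ is the distributive law of the canonical extension of $F$ to the Kleisli category of $T$, and $\rho$ that of the canonical lifting of $G$ to the Eilenberg–Moore category of $T$.) -}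

module Defs where

open import Level using (Level; _⊔_) renaming (suc to lsuc; zero to 0ℓ)
open import Data.Nat using (ℕ; _≟_)
open import Data.Bool using (Bool; true; false)
open import Data.Product using (Σ; _×_; _,_; proj₁; proj₂)
open import Data.Unit using () renaming (⊤ to ⊤₀)
open import Data.Empty using () renaming (⊥ to ⊥₀)
open import Data.Unit.Polymorphic using (⊤)
open import Data.Empty.Polymorphic using (⊥)
open import Data.List using (List; []; _∷_; _++_; reverse)
open import Data.List.Membership.Propositional using (_∈_; _∉_)
open import Relation.Binary.PropositionalEquality using (_≡_; _≢_)
open import Relation.Binary.Structures using (IsEquivalence)
open import Relation.Nullary using (yes; no)
open import Function.Bundles using (_⇔_)

Name : Set
Name = ℕ

swapN : Name → Name → Name → Name
swapN a b c with c ≟ a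
... | yes _ = b
... | no _ with c ≟ b
...   | yes _ = a
...   | no _ = c

-- A finite permutation, presented as a composite of transpositions:
-- (a₁ b₁) ∷ (a₂ b₂) ∷ … denotes (a₁ b₁) ∘ (a₂ b₂) ∘ …
Perm : Set
Perm = List (Name × Name)

perm : Perm → Name → Name
perm [] c = c
perm ((a , b) ∷ π) c = swapN a b (perm π c)

inv : Perm → Perm
inv = reverse

tr : Name → Name → Perm
tr a b = (a , b) ∷ []

Fixes : Perm → List Name → Set
Fixes π L = ∀ a → a ∈ L → perm π a ≡ a

record NomStr c ℓ : Set (lsuc (c ⊔ ℓ)) where
  field
    Carrier : Set c
    _≈_ : Carrier → Carrier → Set ℓ
    act : Perm → Carrier → Carrier

module _ {c ℓ} (A : NomStr c ℓ) where
  open NomStr A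

  Supports : List Name → Carrier → Set ℓ
  Supports L x = ∀ π → Fixes π L → act π x ≈ x

  Fresh : Name → Carrier → Set ℓ
  Fresh d x = Σ (List Name) λ L → Supports L x × d ∉ L

record IsNominal {c ℓ} (A : NomStr c ℓ) : Set (c ⊔ ℓ) where
  open NomStr A
  field
    isEquivalence : IsEquivalence _≈_
    act-cong : ∀ π {x y} → x ≈ y → act π x ≈ act π y
    act-id : ∀ x → act [] x ≈ x
    act-comp : ∀ π σ x → act (π ++ σ) x ≈ act π (act σ x)
    act-ext : ∀ π σ → (∀ a → perm π a ≡ perm σ a) → ∀ x → act π x ≈ act σ x
    finSupp : ∀ x → Σ (List Name) λ L → Supports A L x

record Nominal c ℓ : Set (lsuc (c ⊔ ℓ)) where
  field
    str : NomStr c ℓ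
    isNominal : IsNominal str

-- 2 = {0,1} (0 = false, 1 = true), trivial action
𝟚 : NomStr 0ℓ 0ℓ
𝟚 = record { Carrier = Bool ; _≈_ = _≡_ ; act = λ _ b → b }

_⊗_ : ∀ {c ℓ c' ℓ'} → NomStr c ℓ → NomStr c' ℓ' → NomStr (c ⊔ c') (ℓ ⊔ ℓ')
A ⊗ B = record
  { Carrier = NomStr.Carrier A × NomStr.Carrier B
  ; _≈_ = λ p q → NomStr._≈_ A (proj₁ p) (proj₁ q) × NomStr._≈_ B (proj₂ p) (proj₂ q)
  ; act = λ π p → NomStr.act A π (proj₁ p) , NomStr.act B π (proj₂ p)
  }

-- name abstraction [𝔸]A: pairs (a , x) representing ⟨a⟩x, with
-- ⟨a⟩x = ⟨b⟩y iff (a e)·x = (b e)·y for some e fresh for a, x, b, y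
AbsEq : ∀ {c ℓ} (A : NomStr c ℓ) → Name → NomStr.Carrier A → Name → NomStr.Carrier A → Set ℓ
AbsEq A a x b y = Σ Name λ e → e ≢ a × e ≢ b × Fresh A e x × Fresh A e y
                   × NomStr._≈_ A (NomStr.act A (tr a e) x) (NomStr.act A (tr b e) y)

Abs : ∀ {c ℓ} → NomStr c ℓ → NomStr c ℓ
Abs A = record
  { Carrier = Name × NomStr.Carrier A
  ; _≈_ = λ p q → AbsEq A (proj₁ p) (proj₂ p) (proj₁ q) (proj₂ q)
  ; act = λ π p → perm π (proj₁ p) , NomStr.act A π (proj₂ p)
  }

Exp : ∀ {c ℓ} → NomStr c ℓ → NomStr c ℓ
Exp A = record
  { Carrier = Name → NomStr.Carrier A
  ; _≈_ = λ f g → ∀ a → NomStr._≈_ A (f a) (g a)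
  ; act = λ π f a → NomStr.act A π (f (perm (inv π) a))
  }

data FC {c} (C : Set c) : Set c where
  stop : FC C
  out  : Name → C → FC C
  bnd  : Name → C → FC C

module _ {c ℓ} (A : NomStr c ℓ) where
  open NomStr A

  FRel : FC Carrier → FC Carrier → Set ℓ
  FRel stop stop = ⊤
  FRel (out a x) (out b y) = a ≡ b × x ≈ y
  FRel (bnd a x) (bnd b y) = AbsEq A a x b y
  FRel _ _ = ⊥

  FAct : Perm → FC Carrier → FC Carrier
  FAct π stop = stop
  FAct π (out a x) = out (perm π a) (act π x)
  FAct π (bnd a x) = bnd (perm π a) (act π x)

𝔽 : ∀ {c ℓ} → NomStr c ℓ → NomStr c ℓ
𝔽 A = record { Carrier = FC (NomStr.Carrier A) ; _≈_ = FRel A ; act = FAct A }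

𝔾 : ∀ {c ℓ} → NomStr c ℓ → NomStr c ℓ
𝔾 A = 𝟚 ⊗ (Exp A ⊗ Abs A)

-- T = P_ufs : subsets, given as families indexed by a type in Set p.
record Sub {c} (p : Level) (C : Set c) : Set (lsuc p ⊔ c) where
  constructor fam
  field
    Idx : Set p
    elt : Idx → C
open Sub public

module _ {c ℓ} (A : NomStr c ℓ) where
  open NomStr A

  Mem : ∀ {p} → Carrier → Sub p Carrier → Set (p ⊔ ℓ)
  Mem x S = Σ (Idx S) λ i → elt S i ≈ x

  UFS : ∀ {p} → Sub p Carrier → Set (p ⊔ ℓ)
  UFS S = Σ (List Name) λ L → ∀ i → Supports A L (elt S i)

𝕋 : ∀ {c ℓ} p → NomStr c ℓ → NomStr (lsuc p ⊔ c) (p ⊔ ℓ)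
𝕋 p A = record
  { Carrier = Sub p (NomStr.Carrier A)
  ; _≈_ = λ S S' → (∀ i → Mem A (elt S i) S') × (∀ j → Mem A (elt S' j) S)
  ; act = λ π S → fam (Idx S) (λ i → NomStr.act A π (elt S i))
  }

Tmap : ∀ {c c' p} {C : Set c} {D : Set c'} → (C → D) → Sub p C → Sub p D
Tmap f S = fam (Idx S) (λ i → f (elt S i))

mu : ∀ {c p} {C : Set c} → Sub p (Sub p C) → Sub p C
mu S = fam (Σ (Idx S) λ i → Idx (elt S i)) (λ ij → elt (elt S (proj₁ ij)) (proj₂ ij))

Gmap : ∀ {c c'} {C : Set c} {D : Set c'} → (C → D)
     → Bool × (Name → C) × (Name × C) → Bool × (Name → D) × (Name × D)
Gmap f (b , g , (a , x)) = b , (λ n → f (g n)) , (a , f x)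

lam : ∀ {c p} {C : Set c} → FC (Sub p C) → Sub p (FC C)
lam {p = p} stop = fam ⊤ (λ _ → stop)
lam (out a S) = fam (Idx S) (λ i → out a (elt S i))
lam (bnd a S) = fam (Idx S) (λ i → bnd a (elt S i))

OutAt : ∀ {c} {C : Set c} → Name → FC C → Set
OutAt a (out b x) = b ≡ a
OutAt a _ = ⊥₀

outVal : ∀ {c} {C : Set c} (a : Name) (s : FC C) → OutAt a s → C
outVal a (out b x) _ = x

IsBnd : ∀ {c} {C : Set c} → FC C → Set
IsBnd (bnd b x) = ⊤₀
IsBnd _ = ⊥₀

-- concretion: for ⟨b⟩x and d fresh, the unique y with ⟨d⟩y = ⟨b⟩x is (b d)·x
concAt : ∀ {c ℓ} (A : NomStr c ℓ) (d : Name) (s : FC (NomStr.Carrier A)) → IsBnd s → NomStr.Carrier A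
concAt A d (bnd b x) _ = NomStr.act A (tr b d) x

-- ε_X, with the value b ∈ 2 and the fresh name d supplied
epsilon : ∀ {c ℓ} p (A : NomStr c ℓ) → Bool → Name
        → NomStr.Carrier (𝕋 p (𝔽 A)) → NomStr.Carrier (𝔾 (𝕋 p A))
epsilon p A b d S =
    b
  , (λ a → fam (Σ (Idx S) λ i → OutAt a (elt S i)) (λ io → outVal a (elt S (proj₁ io)) (proj₂ io)))
  , (d , fam (Σ (Idx S) λ i → IsBnd (elt S i)) (λ io → concAt A d (elt S (proj₁ io)) (proj₂ io)))

-- ρ_X, with the value b ∈ 2 and the fresh name d supplied
rho : ∀ {c ℓ} p (A : NomStr c ℓ) → Bool → Name
    → NomStr.Carrier (𝕋 p (𝔾 A)) → NomStr.Carrier (𝔾 (𝕋 p A))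
rho p A b d S =
    b
  , (λ a → fam (Idx S) (λ i → proj₁ (proj₂ (elt S i)) a))
  , (d , fam (Idx S) (λ i → NomStr.act A (tr (proj₁ (proj₂ (proj₂ (elt S i)))) d)
                                         (proj₂ (proj₂ (proj₂ (elt S i))))))

EpsSpec : ∀ {c ℓ} p (A : NomStr c ℓ) → Bool → Name → NomStr.Carrier (𝕋 p (𝔽 A)) → Set (p ⊔ ℓ)
EpsSpec p A b d S = (b ≡ true ⇔ Mem (𝔽 A) stop S) × Fresh (𝕋 p (𝔽 A)) d S

RhoSpec : ∀ {c ℓ} p (A : NomStr c ℓ) → Bool → Name → NomStr.Carrier (𝕋 p (𝔾 A)) → Set (p ⊔ ℓ)
RhoSpec p A b d S = (b ≡ true ⇔ Mem 𝟚 true (Tmap proj₁ S)) × Fresh (𝕋 p (𝔾 A)) d S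

Teps : ∀ {c ℓ} p (A : NomStr c ℓ) (S : NomStr.Carrier (𝕋 p (𝕋 p (𝔽 A))))
     → (Idx S → Bool) → (Idx S → Name) → NomStr.Carrier (𝕋 p (𝔾 (𝕋 p A)))
Teps p A S β δ = fam (Idx S) (λ i → epsilon p A (β i) (δ i) (elt S i))

-- Membership of raw data in the nominal sets TFTX and TTFX
-- (all subsets occurring must be uniformly finitely supported)

WF-F : ∀ {c q} {C : Set c} → (C → Set q) → FC C → Set q
WF-F P stop = ⊤
WF-F P (out a x) = P x
WF-F P (bnd a x) = P x

InTFT : ∀ {c ℓ} p (A : NomStr c ℓ) → NomStr.Carrier (𝕋 p (𝔽 (𝕋 p A))) → Set (p ⊔ ℓ)
InTFT p A S = UFS (𝔽 (𝕋 p A)) S × (∀ i → WF-F (UFS A) (elt S i))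

InTTF : ∀ {c ℓ} p (A : NomStr c ℓ) → NomStr.Carrier (𝕋 p (𝕋 p (𝔽 A))) → Set (p ⊔ ℓ)
InTTF p A S = UFS (𝕋 p (𝔽 A)) S × (∀ i → UFS (𝔽 A) (elt S i))

ExtLaw1 : ∀ {c ℓ} p → Nominal c ℓ → Set (lsuc p ⊔ c ⊔ ℓ)
ExtLaw1 p X =
  (S : NomStr.Carrier (𝕋 p (𝔽 (𝕋 p A)))) → InTFT p A S →
  (bL bR : Bool) (dL dR : Name) →
  EpsSpec p A bL dL (mu (Tmap lam S)) →
  EpsSpec p (𝕋 p A) bR dR S →
  NomStr._≈_ (𝔾 (𝕋 p A))
    (epsilon p A bL dL (mu (Tmap lam S)))
    (Gmap mu (epsilon p (𝕋 p A) bR dR S))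
  where A = Nominal.str X

ExtLaw2 : ∀ {c ℓ} p → Nominal c ℓ → Set (lsuc p ⊔ c ⊔ ℓ)
ExtLaw2 p X =
  (S : NomStr.Carrier (𝕋 p (𝕋 p (𝔽 A)))) → InTTF p A S →
  (bL : Bool) (dL : Name) → EpsSpec p A bL dL (mu S) →
  (β : Idx S → Bool) (δ : Idx S → Name) → (∀ i → EpsSpec p A (β i) (δ i) (elt S i)) →
  (bM : Bool) (dM : Name) → RhoSpec p (𝕋 p A) bM dM (Teps p A S β δ) →
  NomStr._≈_ (𝔾 (𝕋 p A))
    (epsilon p A bL dL (mu S))
    (Gmap mu (rho p (𝕋 p A) bM dM (Teps p A S β δ)))
  where A = Nominal.str X

-- Both laws are checked componentwise. The flag and free-output components of the two sides are
-- the same unions, merely reindexed. The abstraction components are concretions, at the chosen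
-- fresh names d and d′, of the same abstractions ⟨b⟩x; for e fresh for everything, (d e)·(b d)·x
-- and (d′ e)·(b d′)·x both equal (b e)·x, which is what equality in [𝔸](T X) asks for. This needs
-- x to be supported by b together with a support of the ambient set. It holds because an element
-- of a uniformly finitely supported set is supported by every support L of the set: swapping a
-- name outside L with a fresh one fixes the set, so it maps the element to another element, and
-- the two supports so obtained intersect in one without that name.
module Submission where

open import Defs
open import Level using (Level; _⊔_) renaming (suc to lsuc)
open import Data.Nat using (_≟_; suc; _≤_)
open import Data.Nat.ListAction using (sum)
open import Data.Nat.Properties using (m≤m+n; m≤n+m; ≤-trans; n≮n)
open import Data.Bool using (Bool; true; false)
open import Data.Product using (Σ; _×_; _,_; proj₁; proj₂)
open import Data.Sum using (_⊎_; inj₁; inj₂)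
open import Data.Unit.Polymorphic using (tt)
open import Data.Empty using (⊥-elim)
open import Data.List using (List; []; _∷_; _++_; [_])
open import Data.List.Properties using (unfold-reverse)
open import Data.List.Relation.Unary.Any using (here; there)
open import Data.List.Membership.Propositional using (_∈_; _∉_)
open import Data.List.Membership.Propositional.Properties using (∈-++⁺ˡ; ∈-++⁺ʳ)
open import Data.List.Membership.DecPropositional _≟_ using (_∈?_)
open import Relation.Binary.PropositionalEquality
  using (_≡_; _≢_; refl; cong; subst; module ≡-Reasoning)
  renaming (sym to ≡-sym; trans to ≡-trans)
open import Relation.Binary.Structures using (IsEquivalence)
open import Relation.Binary.Bundles using (Setoid)
open import Relation.Nullary using (yes; no; ¬_; Dec)
open import Function.Bundles using (_⇔_; Equivalence)

swap-left : ∀ a b → swapN a b a ≡ b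
swap-left a b with a ≟ a
... | yes _ = refl
... | no a≢a = ⊥-elim (a≢a refl)

swap-right : ∀ a b → swapN a b b ≡ a
swap-right a b with b ≟ a
... | yes b≡a = b≡a
... | no _ with b ≟ b
...   | yes _ = refl
...   | no b≢b = ⊥-elim (b≢b refl)

swap-fixes : ∀ {a b c} → c ≢ a → c ≢ b → swapN a b c ≡ c
swap-fixes {a} {b} {c} c≢a c≢b with c ≟ a
... | yes c≡a = ⊥-elim (c≢a c≡a)
... | no _ with c ≟ b
...   | yes c≡b = ⊥-elim (c≢b c≡b)
...   | no _ = refl

swap-involutive : ∀ a b c → swapN a b (swapN a b c) ≡ c
swap-involutive a b c = cases (c ≟ a) (c ≟ b)
  where
  cases : Dec (c ≡ a) → Dec (c ≡ b) → swapN a b (swapN a b c) ≡ c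
  cases (yes refl) _ = ≡-trans (cong (swapN a b) (swap-left a b)) (swap-right a b)
  cases (no _) (yes refl) = ≡-trans (cong (swapN a b) (swap-right a b)) (swap-left a b)
  cases (no c≢a) (no c≢b) = ≡-trans (cong (swapN a b) (swap-fixes c≢a c≢b)) (swap-fixes c≢a c≢b)

swap-fixes-list : ∀ {a b} (L : List Name) → a ∉ L → b ∉ L → Fixes (tr a b) L
swap-fixes-list L a∉L b∉L z z∈L =
  swap-fixes (λ z≡a → a∉L (subst (_∈ L) z≡a z∈L)) (λ z≡b → b∉L (subst (_∈ L) z≡b z∈L))

perm-++ : ∀ π σ z → perm (π ++ σ) z ≡ perm π (perm σ z)
perm-++ [] σ z = refl
perm-++ ((a , b) ∷ π) σ z = cong (swapN a b) (perm-++ π σ z)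

perm-inverseˡ : ∀ σ z → perm (inv σ) (perm σ z) ≡ z
perm-inverseˡ [] z = refl
perm-inverseˡ ((a , b) ∷ σ) z = begin
    perm (inv ((a , b) ∷ σ)) (swapN a b (perm σ z))
  ≡⟨ cong (λ l → perm l (swapN a b (perm σ z))) (unfold-reverse (a , b) σ) ⟩
    perm (inv σ ++ [ (a , b) ]) (swapN a b (perm σ z))
  ≡⟨ perm-++ (inv σ) [ (a , b) ] _ ⟩
    perm (inv σ) (swapN a b (swapN a b (perm σ z)))
  ≡⟨ cong (perm (inv σ)) (swap-involutive a b _) ⟩
    perm (inv σ) (perm σ z)
  ≡⟨ perm-inverseˡ σ z ⟩
    z ∎
  where open ≡-Reasoning

perm-inverseʳ : ∀ σ z → perm σ (perm (inv σ) z) ≡ z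
perm-inverseʳ [] z = refl
perm-inverseʳ ((a , b) ∷ σ) z = begin
    swapN a b (perm σ (perm (inv ((a , b) ∷ σ)) z))
  ≡⟨ cong (λ l → swapN a b (perm σ (perm l z))) (unfold-reverse (a , b) σ) ⟩
    swapN a b (perm σ (perm (inv σ ++ [ (a , b) ]) z))
  ≡⟨ cong (λ w → swapN a b (perm σ w)) (perm-++ (inv σ) [ (a , b) ] z) ⟩
    swapN a b (perm σ (perm (inv σ) (swapN a b z)))
  ≡⟨ cong (swapN a b) (perm-inverseʳ σ _) ⟩
    swapN a b (swapN a b z)
  ≡⟨ swap-involutive a b z ⟩
    z ∎
  where open ≡-Reasoning

perm-injective : ∀ σ {x y} → perm σ x ≡ perm σ y → x ≡ y
perm-injective σ {x} {y} eq =
  ≡-trans (≡-sym (perm-inverseˡ σ x)) (≡-trans (cong (perm (inv σ)) eq) (perm-inverseˡ σ y))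

swap-conjugate : ∀ {a b f} → a ≢ b → f ≢ a → f ≢ b → ∀ z →
                 perm ((b , f) ∷ (a , f) ∷ (b , f) ∷ []) z ≡ swapN a b z
swap-conjugate {a} {b} {f} a≢b f≢a f≢b z = cases (z ≟ a) (z ≟ b) (z ≟ f)
  where
  open ≡-Reasoning
  cases : Dec (z ≡ a) → Dec (z ≡ b) → Dec (z ≡ f) →
          perm ((b , f) ∷ (a , f) ∷ (b , f) ∷ []) z ≡ swapN a b z
  cases (yes refl) _ _ = begin
      swapN b f (swapN z f (swapN b f z))
        ≡⟨ cong (λ w → swapN b f (swapN z f w)) (swap-fixes a≢b (λ z≡f → f≢a (≡-sym z≡f))) ⟩
      swapN b f (swapN z f z)              ≡⟨ cong (swapN b f) (swap-left z f) ⟩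
      swapN b f f                          ≡⟨ swap-right b f ⟩
      b                                    ≡⟨ swap-left z b ⟨
      swapN z b z                          ∎
  cases (no _) (yes refl) _ = begin
      swapN z f (swapN a f (swapN z f z))  ≡⟨ cong (λ w → swapN z f (swapN a f w)) (swap-left z f) ⟩
      swapN z f (swapN a f f)              ≡⟨ cong (swapN z f) (swap-right a f) ⟩
      swapN z f a                          ≡⟨ swap-fixes a≢b (λ a≡f → f≢a (≡-sym a≡f)) ⟩
      a                                    ≡⟨ swap-right a z ⟨
      swapN a z z                          ∎
  cases (no z≢a) (no z≢b) (yes refl) = begin
      swapN b z (swapN a z (swapN b z z))  ≡⟨ cong (λ w → swapN b z (swapN a z w)) (swap-right b z) ⟩
      swapN b z (swapN a z b)
        ≡⟨ cong (swapN b z) (swap-fixes (λ b≡a → a≢b (≡-sym b≡a)) (λ b≡z → f≢b (≡-sym b≡z))) ⟩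
      swapN b z b                          ≡⟨ swap-left b z ⟩
      z                                    ≡⟨ swap-fixes z≢a z≢b ⟨
      swapN a b z                          ∎
  cases (no z≢a) (no z≢b) (no z≢f) = begin
      swapN b f (swapN a f (swapN b f z))  ≡⟨ cong (λ w → swapN b f (swapN a f w)) (swap-fixes z≢b z≢f) ⟩
      swapN b f (swapN a f z)              ≡⟨ cong (swapN b f) (swap-fixes z≢a z≢f) ⟩
      swapN b f z                          ≡⟨ swap-fixes z≢b z≢f ⟩
      z                                    ≡⟨ swap-fixes z≢a z≢b ⟨
      swapN a b z                          ∎

fresh : List Name → Name
fresh L = suc (sum L)

fresh-∉ : ∀ L → fresh L ∉ L
fresh-∉ L p = n≮n (sum L) (∈⇒≤sum L p)
  where
  ∈⇒≤sum : ∀ {x} L → x ∈ L → x ≤ sum L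
  ∈⇒≤sum (y ∷ L) (here refl) = m≤m+n y (sum L)
  ∈⇒≤sum (y ∷ L) (there p) = ≤-trans (∈⇒≤sum L p) (m≤n+m (sum L) y)

-- The laws of IsNominal except finite support, which the subsets in 𝕋 need not have.
record IsPermAction {c ℓ} (B : NomStr c ℓ) : Set (c ⊔ ℓ) where
  open NomStr B
  field
    isEquivalence : IsEquivalence _≈_
    act-cong : ∀ π {x y} → x ≈ y → act π x ≈ act π y
    act-id : ∀ x → act [] x ≈ x
    act-comp : ∀ π σ x → act (π ++ σ) x ≈ act π (act σ x)
    act-ext : ∀ π σ → (∀ a → perm π a ≡ perm σ a) → ∀ x → act π x ≈ act σ x

isPermAction : ∀ {c ℓ} (X : Nominal c ℓ) → IsPermAction (Nominal.str X)
isPermAction X = record { IsNominal (Nominal.isNominal X) }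

module Support {c ℓ} (B : NomStr c ℓ) (isPA : IsPermAction B) where
  open NomStr B
  open IsPermAction isPA
  open IsEquivalence isEquivalence public renaming (refl to ≈-refl)

  ≈-setoid : Setoid c ℓ
  ≈-setoid = record { isEquivalence = isEquivalence }

  Supported : (Name → Set) → Carrier → Set ℓ
  Supported P x = ∀ π → (∀ a → P a → perm π a ≡ a) → act π x ≈ x

  supported-mono : ∀ {P Q : Name → Set} {x} → (∀ z → P z → Q z) → Supported P x → Supported Q x
  supported-mono P⊆Q s π fix = s π (λ a Pa → fix a (P⊆Q a Pa))

  supported-resp : ∀ {P x y} → x ≈ y → Supported P x → Supported P y
  supported-resp x≈y s π fix = trans (act-cong π (sym x≈y)) (trans (s π fix) x≈y)

  act-agree : ∀ {P x} σ σ′ → Supported P x → (∀ z → P z → perm σ z ≡ perm σ′ z) → act σ x ≈ act σ′ x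
  act-agree {P} {x} σ σ′ s agree =
    trans (act-ext σ (σ′ ++ (inv σ′ ++ σ)) split x)
      (trans (act-comp σ′ (inv σ′ ++ σ) x) (act-cong σ′ (s (inv σ′ ++ σ) fix)))
    where
    split : ∀ a → perm σ a ≡ perm (σ′ ++ (inv σ′ ++ σ)) a
    split a = ≡-sym (≡-trans (perm-++ σ′ (inv σ′ ++ σ) a)
                    (≡-trans (cong (perm σ′) (perm-++ (inv σ′) σ a)) (perm-inverseʳ σ′ (perm σ a))))
    fix : ∀ a → P a → perm (inv σ′ ++ σ) a ≡ a
    fix a Pa = ≡-trans (perm-++ (inv σ′) σ a)
                       (≡-trans (cong (perm (inv σ′)) (agree a Pa)) (perm-inverseˡ σ′ a))

  supported-act : ∀ {P Q : Name → Set} {x} τ → Supported P x → (∀ z → P z → Q (perm τ z)) →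
                  Supported Q (act τ x)
  supported-act {x = x} τ s τP⊆Q π fix =
    trans (sym (act-comp π τ x))
          (act-agree (π ++ τ) τ s (λ z Pz → ≡-trans (perm-++ π τ z) (fix _ (τP⊆Q z Pz))))

  swap-act-involutive : ∀ a b x → act (tr a b) (act (tr a b) x) ≈ x
  swap-act-involutive a b x =
    trans (sym (act-comp (tr a b) (tr a b) x))
          (trans (act-ext (tr a b ++ tr a b) [] (swap-involutive a b) x) (act-id x))

  swap-act-fresh : ∀ {P x} a b → Supported P x → ¬ P a → ¬ P b → act (tr a b) x ≈ x
  swap-act-fresh a b s ¬Pa ¬Pb =
    s (tr a b) (λ z Pz → swap-fixes (λ z≡a → ¬Pa (subst _ z≡a Pz)) (λ z≡b → ¬Pb (subst _ z≡b Pz)))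

  -- If π moves c to c′ then c′ ∉ P, so π·x = (c c′)·((c c′) ∷ π)·x with (c c′) ∷ π fixing P;
  -- and (c c′) = (c′ f)(c f)(c′ f) for a fresh f, each factor fixing x.
  supported-remove : ∀ {P : Name → Set} {x} (K : List Name) → (∀ z → P z → z ∈ K) → Supported P x →
                     (L : List Name) → Supported (_∈ L) x → ∀ {c} → c ∉ L →
                     Supported (λ z → P z × z ≢ c) x
  supported-remove {P} {x} K P⊆K s L sL {c} c∉L π fix with perm π c ≟ c
  ... | yes πc≡c = s π fixP
    where
    fixP : ∀ a → P a → perm π a ≡ a
    fixP a Pa with a ≟ c
    ... | yes refl = πc≡c
    ... | no a≢c = fix a (Pa , a≢c)
  ... | no πc≢c = begin
      act π x
    ≈⟨ act-ext π ((c , c′) ∷ τ) (λ a → ≡-sym (swap-involutive c c′ (perm π a))) x ⟩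
      act (tr c c′ ++ τ) x
    ≈⟨ act-comp (tr c c′) τ x ⟩
      act (tr c c′) (act τ x)
    ≈⟨ act-cong (tr c c′) (s τ τ-fixes-P) ⟩
      act (tr c c′) x
    ≈⟨ act-ext (tr c c′) (tr c′ f ++ tr c f ++ tr c′ f)
               (λ z → ≡-sym (swap-conjugate (λ c≡c′ → πc≢c (≡-sym c≡c′)) f≢c f≢c′ z)) x ⟩
      act (tr c′ f ++ tr c f ++ tr c′ f) x
    ≈⟨ act-comp (tr c′ f) (tr c f ++ tr c′ f) x ⟩
      act (tr c′ f) (act (tr c f ++ tr c′ f) x)
    ≈⟨ act-cong (tr c′ f) (act-comp (tr c f) (tr c′ f) x) ⟩
      act (tr c′ f) (act (tr c f) (act (tr c′ f) x))
    ≈⟨ act-cong (tr c′ f) (act-cong (tr c f) c′f-fixes) ⟩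
      act (tr c′ f) (act (tr c f) x)
    ≈⟨ act-cong (tr c′ f) cf-fixes ⟩
      act (tr c′ f) x
    ≈⟨ c′f-fixes ⟩
      x
    ∎
    where
    open import Relation.Binary.Reasoning.Setoid ≈-setoid
    c′ : Name
    c′ = perm π c
    τ : Perm
    τ = (c , c′) ∷ π
    ¬Pc′ : ¬ P c′
    ¬Pc′ Pc′ = πc≢c (perm-injective π (fix c′ (Pc′ , πc≢c)))
    τ-fixes-P : ∀ z → P z → perm τ z ≡ z
    τ-fixes-P z Pz with z ≟ c
    ... | yes refl = swap-right z c′
    ... | no z≢c = ≡-trans (cong (swapN c c′) (fix z (Pz , z≢c)))
                           (swap-fixes z≢c (λ z≡c′ → ¬Pc′ (subst P z≡c′ Pz)))
    f : Name
    f = fresh (K ++ L ++ c ∷ c′ ∷ [])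
    f∉ : f ∉ K ++ L ++ c ∷ c′ ∷ []
    f∉ = fresh-∉ (K ++ L ++ c ∷ c′ ∷ [])
    f≢c : f ≢ c
    f≢c f≡c = f∉ (∈-++⁺ʳ K (∈-++⁺ʳ L (here f≡c)))
    f≢c′ : f ≢ c′
    f≢c′ f≡c′ = f∉ (∈-++⁺ʳ K (∈-++⁺ʳ L (there (here f≡c′))))
    c′f-fixes : act (tr c′ f) x ≈ x
    c′f-fixes = swap-act-fresh c′ f s ¬Pc′ (λ Pf → f∉ (∈-++⁺ˡ (P⊆K f Pf)))
    cf-fixes : act (tr c f) x ≈ x
    cf-fixes = swap-act-fresh {P = _∈ L} c f sL c∉L (λ f∈L → f∉ (∈-++⁺ʳ K (∈-++⁺ˡ f∈L)))

  supported-drop : ∀ {y} a c (Q : List Name) → a ∉ Q → c ∉ Q → c ≢ a →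
                   Supported (_∈ a ∷ Q) y → Supported (_∈ a ∷ Q) (act (tr a c) y) → Supported (_∈ Q) y
  supported-drop {y} a c Q a∉Q c∉Q c≢a sy sy′ =
    supported-resp (swap-act-involutive a c y) (supported-act (tr a c) swapped-by-Q Q-fixed)
    where
    Q-fixed : ∀ z → z ∈ Q → swapN a c z ∈ Q
    Q-fixed z z∈Q = subst (_∈ Q) (≡-sym (swap-fixes-list Q a∉Q c∉Q z z∈Q)) z∈Q
    swapped-by-cQ : Supported (_∈ c ∷ Q) (act (tr a c) y)
    swapped-by-cQ = supported-act (tr a c) sy moved
      where
      moved : ∀ z → z ∈ a ∷ Q → swapN a c z ∈ c ∷ Q
      moved z (here refl) = here (swap-left z c)
      moved z (there z∈Q) = there (Q-fixed z z∈Q)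
    swapped-by-Q : Supported (_∈ Q) (act (tr a c) y)
    swapped-by-Q = supported-mono drop-c
                     (supported-remove (c ∷ Q) (λ _ z∈ → z∈) swapped-by-cQ (a ∷ Q) sy′ c∉aQ)
      where
      c∉aQ : c ∉ a ∷ Q
      c∉aQ (here c≡a) = c≢a c≡a
      c∉aQ (there c∈Q) = c∉Q c∈Q
      drop-c : ∀ z → z ∈ c ∷ Q × z ≢ c → z ∈ Q
      drop-c z (here z≡c , z≢c) = ⊥-elim (z≢c z≡c)
      drop-c z (there z∈Q , _) = z∈Q

  -- A support L of a set is a support of each of its elements, provided the elements are
  -- uniformly supported by some R: each name of R outside L is dropped by swapping it with a fresh one.
  family-supported : ∀ {k} (L : List Name) {K : Set k} (y : K → Carrier) →
                     (∀ π → Fixes π L → ∀ i → Σ K λ j → y j ≈ act π (y i)) →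
                     (R : List Name) → (∀ i → Supported (_∈ R) (y i)) → ∀ i → Supported (_∈ L) (y i)
  family-supported L {K} y closed R sR = drop-all R (λ i → supported-mono (λ _ → ∈-++⁺ˡ) (sR i))
    where
    drop-all : (R : List Name) → (∀ i → Supported (_∈ R ++ L) (y i)) → ∀ i → Supported (_∈ L) (y i)
    drop-all [] s = s
    drop-all (a ∷ R) s = drop-all R drop-a
      where
      drop-a : ∀ i → Supported (_∈ R ++ L) (y i)
      drop-a i with a ∈? (R ++ L)
      ... | yes a∈ = supported-mono (λ { z (here refl) → a∈ ; z (there z∈) → z∈ }) (s i)
      ... | no a∉ = supported-drop a f (R ++ L) a∉ (λ f∈ → f∉ (there f∈)) (λ f≡a → f∉ (here f≡a))
                      (s i) (supported-resp (proj₂ swapped) (s (proj₁ swapped)))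
        where
        f : Name
        f = fresh (a ∷ R ++ L)
        f∉ : f ∉ a ∷ R ++ L
        f∉ = fresh-∉ (a ∷ R ++ L)
        swapped : Σ K λ j → y j ≈ act (tr a f) (y i)
        swapped = closed (tr a f) (swap-fixes-list L (λ a∈L → a∉ (∈-++⁺ʳ R a∈L))
                                                     (λ f∈L → f∉ (there (∈-++⁺ʳ R f∈L)))) i

  absEq-supported : ∀ {a x b y} (W : List Name) → AbsEq B a x b y →
                    Supported (_∈ a ∷ W) x → Supported (_∈ b ∷ W) y
  absEq-supported {a} {x} {b} {y} W (e , e≢a , e≢b , (Lx , sx , e∉Lx) , (Ly , sy , e∉Ly) , eq) sx′ =
    supported-mono forget-e (supported-remove (b ∷ e ∷ W) (λ _ z∈ → z∈) y-by-beW Ly sy e∉Ly)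
    where
    τ : Perm
    τ = (b , e) ∷ (a , e) ∷ []
    τx≈y : act τ x ≈ y
    τx≈y = trans (act-comp (tr b e) (tr a e) x) (trans (act-cong (tr b e) eq) (swap-act-involutive b e y))
    moved : ∀ z → z ∈ a ∷ W × z ≢ e → perm τ z ∈ b ∷ e ∷ W
    moved z (z∈ , z≢e) = cases (z ≟ a) (z ≟ b)
      where
      cases : Dec (z ≡ a) → Dec (z ≡ b) → perm τ z ∈ b ∷ e ∷ W
      cases (yes refl) _ = here (≡-trans (cong (swapN b e) (swap-left z e)) (swap-right b e))
      cases (no z≢a) (yes refl) =
        there (here (≡-trans (cong (swapN z e) (swap-fixes z≢a z≢e)) (swap-left z e)))
      cases (no z≢a) (no z≢b) = there (there (subst (_∈ W)
        (≡-sym (≡-trans (cong (swapN b e) (swap-fixes z≢a z≢e)) (swap-fixes z≢b z≢e))) (tail z∈)))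
        where
        tail : z ∈ a ∷ W → z ∈ W
        tail (here z≡a) = ⊥-elim (z≢a z≡a)
        tail (there z∈W) = z∈W
    y-by-beW : Supported (_∈ b ∷ e ∷ W) y
    y-by-beW = supported-resp τx≈y
                 (supported-act τ (supported-remove (a ∷ W) (λ _ z∈ → z∈) sx′ Lx sx e∉Lx) moved)
    forget-e : ∀ z → z ∈ b ∷ e ∷ W × z ≢ e → z ∈ b ∷ W
    forget-e z (here z≡b , _) = here z≡b
    forget-e z (there (here z≡e) , z≢e) = ⊥-elim (z≢e z≡e)
    forget-e z (there (there z∈W) , _) = there z∈W

  abs-body-supported : ∀ {b y} (L : List Name) → (∀ π → Fixes π L → AbsEq B (perm π b) (act π y) b y) →
                       Supported (_∈ b ∷ L) y
  abs-body-supported {b} {y} L fixed π fix with fixed π (λ a a∈L → fix a (there a∈L))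
  ... | e , _ , _ , _ , _ , πb-eq =
    trans (sym (swap-act-involutive b e (act π y)))
          (trans (act-cong (tr b e) b-eq) (swap-act-involutive b e y))
    where
    b-eq : act (tr b e) (act π y) ≈ act (tr b e) y
    b-eq = subst (λ w → act (tr w e) (act π y) ≈ act (tr b e) y) (fix b (here refl)) πb-eq

  binder-family-supported : ∀ {k} (L : List Name) {K : Set k} (b : K → Name) (x : K → Carrier) →
                            (∀ π → Fixes π L → ∀ i →
                               Σ K λ j → AbsEq B (b j) (x j) (perm π (b i)) (act π (x i))) →
                            (R : List Name) → (∀ i → Supported (_∈ b i ∷ R) (x i)) →
                            ∀ i → Supported (_∈ b i ∷ L) (x i)
  binder-family-supported L {K} b x closed R sR =
    drop-all R λ i → supported-mono (λ { z (here z≡b) → here z≡b ; z (there z∈) → there (∈-++⁺ˡ z∈) }) (sR i)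
    where
    drop-all : (R : List Name) → (∀ i → Supported (_∈ b i ∷ R ++ L) (x i)) →
               ∀ i → Supported (_∈ b i ∷ L) (x i)
    drop-all [] s = s
    drop-all (a ∷ R) s = drop-all R drop-a
      where
      drop-a : ∀ i → Supported (_∈ b i ∷ R ++ L) (x i)
      drop-a i with a ∈? (b i ∷ R ++ L)
      ... | yes a∈ = supported-mono drop-duplicate (s i)
        where
        drop-duplicate : ∀ z → z ∈ b i ∷ a ∷ R ++ L → z ∈ b i ∷ R ++ L
        drop-duplicate z (here z≡b) = here z≡b
        drop-duplicate z (there (here refl)) = a∈
        drop-duplicate z (there (there z∈)) = there z∈
      ... | no a∉ = supported-drop a f (b i ∷ R ++ L) a∉ f∉biRL (λ f≡a → f∉ (there (here f≡a)))
                      (supported-mono exchange (s i)) (supported-mono exchange′ swapped-supported)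
        where
        f : Name
        f = fresh (b i ∷ a ∷ R ++ L)
        f∉ : f ∉ b i ∷ a ∷ R ++ L
        f∉ = fresh-∉ (b i ∷ a ∷ R ++ L)
        f∉biRL : f ∉ b i ∷ R ++ L
        f∉biRL (here f≡b) = f∉ (here f≡b)
        f∉biRL (there f∈) = f∉ (there (there f∈))
        exchange : ∀ z → z ∈ b i ∷ a ∷ R ++ L → z ∈ a ∷ b i ∷ R ++ L
        exchange z (here z≡b) = there (here z≡b)
        exchange z (there (here z≡a)) = here z≡a
        exchange z (there (there z∈)) = there (there z∈)
        swapped : Σ K λ j → AbsEq B (b j) (x j) (perm (tr a f) (b i)) (act (tr a f) (x i))
        swapped = closed (tr a f) (swap-fixes-list L (λ a∈L → a∉ (there (∈-++⁺ʳ R a∈L)))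
                                                     (λ f∈L → f∉ (there (there (∈-++⁺ʳ R f∈L))))) i
        b-fixed : perm (tr a f) (b i) ≡ b i
        b-fixed = swap-fixes (λ b≡a → a∉ (here (≡-sym b≡a))) (λ b≡f → f∉ (here (≡-sym b≡f)))
        swapped-supported : Supported (_∈ perm (tr a f) (b i) ∷ a ∷ R ++ L) (act (tr a f) (x i))
        swapped-supported = absEq-supported (a ∷ R ++ L) (proj₂ swapped) (s (proj₁ swapped))
        exchange′ : ∀ z → z ∈ perm (tr a f) (b i) ∷ a ∷ R ++ L → z ∈ a ∷ b i ∷ R ++ L
        exchange′ z (here z≡b) = there (here (≡-trans z≡b b-fixed))
        exchange′ z (there z∈) = exchange z (there z∈)

  -- d ∉ L makes d fresh for ⟨b⟩x, so d can occur in the support of x only as b.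
  supported-apart : ∀ {x} b d (W L : List Name) → Supported (_∈ b ∷ W) x → Supported (_∈ b ∷ L) x → d ∉ L →
                    Supported (λ z → z ≡ b ⊎ (z ≢ d × z ∈ W)) x
  supported-apart b d W L sW sL d∉L with d ≟ b
  ... | yes refl = supported-mono split sW
    where
    split : ∀ z → z ∈ b ∷ W → z ≡ b ⊎ (z ≢ b × z ∈ W)
    split z (here z≡b) = inj₁ z≡b
    split z (there z∈W) with z ≟ b
    ... | yes z≡b = inj₁ z≡b
    ... | no z≢b = inj₂ (z≢b , z∈W)
  ... | no d≢b = supported-mono split (supported-remove (b ∷ W) (λ _ z∈ → z∈) sW (b ∷ L) sL d∉bL)
    where
    d∉bL : d ∉ b ∷ L
    d∉bL (here d≡b) = d≢b d≡b
    d∉bL (there d∈L) = d∉L d∈L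
    split : ∀ z → z ∈ b ∷ W × z ≢ d → z ≡ b ⊎ (z ≢ d × z ∈ W)
    split z (here z≡b , _) = inj₁ z≡b
    split z (there z∈W , z≢d) = inj₂ (z≢d , z∈W)

  concretion-swap : ∀ {x} b d e (W L : List Name) → Supported (_∈ b ∷ W) x → Supported (_∈ b ∷ L) x →
                    d ∉ L → e ∉ W → act (tr d e) (act (tr b d) x) ≈ act (tr b e) x
  concretion-swap {x} b d e W L sW sL d∉L e∉W =
    trans (sym (act-comp (tr d e) (tr b d) x))
          (act-agree (tr d e ++ tr b d) (tr b e) (supported-apart b d W L sW sL d∉L) agree)
    where
    agree : ∀ z → z ≡ b ⊎ (z ≢ d × z ∈ W) → swapN d e (swapN b d z) ≡ swapN b e z
    agree z (inj₁ refl) =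
      ≡-trans (cong (swapN d e) (swap-left z d)) (≡-trans (swap-left d e) (≡-sym (swap-left z e)))
    agree z (inj₂ (z≢d , z∈W)) = cases (z ≟ b)
      where
      z≢e : z ≢ e
      z≢e z≡e = e∉W (subst (_∈ W) z≡e z∈W)
      cases : Dec (z ≡ b) → swapN d e (swapN b d z) ≡ swapN b e z
      cases (yes refl) = agree z (inj₁ refl)
      cases (no z≢b) = ≡-trans (cong (swapN d e) (swap-fixes z≢b z≢d))
                               (≡-trans (swap-fixes z≢d z≢e) (≡-sym (swap-fixes z≢b z≢e)))

  concretion-supported : ∀ {x} b d (W L : List Name) → Supported (_∈ b ∷ W) x → Supported (_∈ b ∷ L) x →
                         d ∉ L → Supported (_∈ d ∷ W) (act (tr b d) x)
  concretion-supported b d W L sW sL d∉L = supported-act (tr b d) (supported-apart b d W L sW sL d∉L) moved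
    where
    moved : ∀ z → z ≡ b ⊎ (z ≢ d × z ∈ W) → swapN b d z ∈ d ∷ W
    moved z (inj₁ refl) = here (swap-left z d)
    moved z (inj₂ (z≢d , z∈W)) = cases (z ≟ b)
      where
      cases : Dec (z ≡ b) → swapN b d z ∈ d ∷ W
      cases (yes refl) = moved z (inj₁ refl)
      cases (no z≢b) = there (subst (_∈ W) (≡-sym (swap-fixes z≢b z≢d)) z∈W)

  concretions-agree : ∀ {x} b d d′ e (L L′ : List Name) → Supported (_∈ b ∷ L) x → Supported (_∈ b ∷ L′) x →
                      d ∉ L → d′ ∉ L′ → e ∉ L → e ∉ L′ →
                      act (tr d e) (act (tr b d) x) ≈ act (tr d′ e) (act (tr b d′) x)
  concretions-agree b d d′ e L L′ s s′ d∉ d′∉ e∉ e∉′ =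
    trans (concretion-swap b d e L L s s d∉ e∉) (sym (concretion-swap b d′ e L′ L′ s′ s′ d′∉ e∉′))

  absEq-intro : ∀ {a x b y} (La Lb : List Name) → Supported (_∈ a ∷ La) x → Supported (_∈ b ∷ Lb) y →
                (∀ e → e ∉ La → e ∉ Lb → act (tr a e) x ≈ act (tr b e) y) → AbsEq B a x b y
  absEq-intro {a} {x} {b} {y} La Lb sx sy eq =
    e , (λ e≡a → e∉ (here e≡a)) , (λ e≡b → e∉ (there (here e≡b)))
      , (a ∷ La , sx , e∉aLa) , (b ∷ Lb , sy , e∉bLb) , eq e e∉La e∉Lb
    where
    e : Name
    e = fresh (a ∷ b ∷ La ++ Lb)
    e∉ : e ∉ a ∷ b ∷ La ++ Lb
    e∉ = fresh-∉ (a ∷ b ∷ La ++ Lb)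
    e∉La : e ∉ La
    e∉La e∈ = e∉ (there (there (∈-++⁺ˡ e∈)))
    e∉Lb : e ∉ Lb
    e∉Lb e∈ = e∉ (there (there (∈-++⁺ʳ La e∈)))
    e∉aLa : e ∉ a ∷ La
    e∉aLa (here e≡a) = e∉ (here e≡a)
    e∉aLa (there e∈) = e∉La e∈
    e∉bLb : e ∉ b ∷ Lb
    e∉bLb (here e≡b) = e∉ (there (here e≡b))
    e∉bLb (there e∈) = e∉Lb e∈

  set-supported : ∀ {p} (S : Sub p Carrier) (L : List Name) → (∀ i → Supported (_∈ L) (elt S i)) →
                  Supports (𝕋 p B) L S
  set-supported S L s π fix = (λ i → i , sym (s i π fix)) , (λ j → j , s j π fix)

𝕋-isPermAction : ∀ {c ℓ} p (B : NomStr c ℓ) → IsPermAction B → IsPermAction (𝕋 p B)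
𝕋-isPermAction p B isPA = record
  { isEquivalence = record
      { refl = (λ i → i , ≈-refl) , (λ i → i , ≈-refl)
      ; sym = λ (⊆ , ⊇) → ⊇ , ⊆
      ; trans = λ (⊆₁ , ⊇₁) (⊆₂ , ⊇₂) →
          (λ i → proj₁ (⊆₂ (proj₁ (⊆₁ i))) , trans (proj₂ (⊆₂ (proj₁ (⊆₁ i)))) (proj₂ (⊆₁ i)))
        , (λ j → proj₁ (⊇₁ (proj₁ (⊇₂ j))) , trans (proj₂ (⊇₁ (proj₁ (⊇₂ j)))) (proj₂ (⊇₂ j)))
      }
  ; act-cong = λ π (⊆ , ⊇) → (λ i → proj₁ (⊆ i) , act-cong π (proj₂ (⊆ i)))
                           , (λ j → proj₁ (⊇ j) , act-cong π (proj₂ (⊇ j)))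
  ; act-id = λ S → (λ i → i , sym (act-id _)) , (λ i → i , act-id _)
  ; act-comp = λ π σ S → (λ i → i , sym (act-comp π σ _)) , (λ i → i , act-comp π σ _)
  ; act-ext = λ π σ agree S → (λ i → i , sym (act-ext π σ agree _)) , (λ i → i , act-ext π σ agree _)
  }
  where
  open IsPermAction isPA
  open IsEquivalence isEquivalence renaming (refl to ≈-refl)

binder : ∀ {c} {C : Set c} (s : FC C) → IsBnd s → Name
binder (bnd b x) _ = b

body : ∀ {c} {C : Set c} (s : FC C) → IsBnd s → C
body (bnd b x) _ = x

Bound : ∀ {c p} {C : Set c} → Sub p (FC C) → Set p
Bound S = Σ (Idx S) λ i → IsBnd (elt S i)

boundName : ∀ {c p} {C : Set c} (S : Sub p (FC C)) → Bound S → Name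
boundName S (i , bs) = binder (elt S i) bs

boundBody : ∀ {c p} {C : Set c} (S : Sub p (FC C)) → Bound S → C
boundBody S (i , bs) = body (elt S i) bs

≡-from-true⇔ : ∀ {a b} {P : Set a} {Q : Set b} {x y : Bool} →
               (x ≡ true ⇔ P) → (y ≡ true ⇔ Q) → (P → Q) → (Q → P) → x ≡ y
≡-from-true⇔ {x = true} {true} _ _ _ _ = refl
≡-from-true⇔ {x = false} {false} _ _ _ _ = refl
≡-from-true⇔ {x = true} {false} x⇔P y⇔Q P→Q _ with Equivalence.from y⇔Q (P→Q (Equivalence.to x⇔P refl))
... | ()
≡-from-true⇔ {x = false} {true} x⇔P y⇔Q _ Q→P with Equivalence.from x⇔P (Q→P (Equivalence.to y⇔Q refl))
... | ()

module BoundSupport {c ℓ} (B : NomStr c ℓ) (isPA : IsPermAction B) where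
  open NomStr B
  open Support B isPA

  bnd-related : ∀ π (s t : FC Carrier) (bs : IsBnd s) → FRel B t (FAct B π s) →
                Σ (IsBnd t) λ bt → AbsEq B (binder t bt) (body t bt) (perm π (binder s bs)) (act π (body s bs))
  bnd-related π (bnd a x) (bnd b y) _ r = _ , r

  bound-body-supported : ∀ {L} (s : FC Carrier) (bs : IsBnd s) → Supports (𝔽 B) L s →
                         Supported (_∈ binder s bs ∷ L) (body s bs)
  bound-body-supported {L} (bnd b x) _ s = abs-body-supported L s

  bound-bodies-supported : ∀ {p} (S : Sub p (FC Carrier)) (L : List Name) → Supports (𝕋 p (𝔽 B)) L S →
                           (R : List Name) → (∀ k → Supported (_∈ boundName S k ∷ R) (boundBody S k)) →
                           ∀ k → Supported (_∈ boundName S k ∷ L) (boundBody S k)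
  bound-bodies-supported S L sS = binder-family-supported L (boundName S) (boundBody S) closed
    where
    closed : ∀ π → Fixes π L → ∀ k → Σ (Bound S) λ k′ →
             AbsEq B (boundName S k′) (boundBody S k′) (perm π (boundName S k)) (act π (boundBody S k))
    closed π fix (i , bs) =
      let (j , r) = proj₁ (sS π fix) i
          (bt , eq) = bnd-related π (elt S i) (elt S j) bs r
      in (j , bt) , eq

  ufs-bound-bodies-supported : ∀ {p} (S : Sub p (FC Carrier)) (L : List Name) → Supports (𝕋 p (𝔽 B)) L S →
                               UFS (𝔽 B) S → ∀ k → Supported (_∈ boundName S k ∷ L) (boundBody S k)
  ufs-bound-bodies-supported S L sS (R , sR) =
    bound-bodies-supported S L sS R (λ (i , bs) → bound-body-supported (elt S i) bs (sR i))

  elements-supported : ∀ {p} (S : Sub p Carrier) (L : List Name) → Supports (𝕋 p B) L S → UFS B S →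
                       ∀ i → Supported (_∈ L) (elt S i)
  elements-supported S L sS (R , sR) = family-supported L (elt S) (λ π fix → proj₁ (sS π fix)) R sR

  concAt-supported : ∀ d (s : FC Carrier) bs (W L : List Name) → Supported (_∈ binder s bs ∷ W) (body s bs) →
                     Supported (_∈ binder s bs ∷ L) (body s bs) → d ∉ L → Supported (_∈ d ∷ W) (concAt B d s bs)
  concAt-supported d (bnd b x) _ = concretion-supported b d

  concAt-swap : ∀ d e (s : FC Carrier) bs (W L : List Name) → Supported (_∈ binder s bs ∷ W) (body s bs) →
                Supported (_∈ binder s bs ∷ L) (body s bs) → d ∉ L → e ∉ W →
                act (tr d e) (concAt B d s bs) ≈ act (tr (binder s bs) e) (body s bs)
  concAt-swap d e (bnd b x) _ = concretion-swap b d e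

module ExtensionLaw1 {c ℓ} (p : Level) (X : Nominal c ℓ) where
  private
    A : NomStr c ℓ
    A = Nominal.str X
    TA : NomStr (lsuc p ⊔ c) (p ⊔ ℓ)
    TA = 𝕋 p A
    isPA : IsPermAction A
    isPA = isPermAction X
  open NomStr A
  open Support A isPA
  open BoundSupport A isPA
  module T where
    open Support TA (𝕋-isPermAction p A isPA) public
    open BoundSupport TA (𝕋-isPermAction p A isPA) public

  lam-stop : (s : FC (Sub p Carrier)) (j : Idx (lam s)) → FRel A (elt (lam s) j) stop → FRel TA s stop
  lam-stop stop _ _ = tt

  lam-stop⁻ : (s : FC (Sub p Carrier)) → FRel TA s stop →
              Σ (Idx (lam s)) λ j → FRel A (elt (lam s) j) stop
  lam-stop⁻ stop _ = tt , tt

  lam-out : ∀ a (s : FC (Sub p Carrier)) j (o : OutAt a (elt (lam s) j)) →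
            Σ (OutAt a s) λ o′ → Mem A (outVal a (elt (lam s) j) o) (outVal a s o′)
  lam-out a (out b S′) j o = o , j , ≈-refl

  lam-out⁻ : ∀ a (s : FC (Sub p Carrier)) (o′ : OutAt a s) (k : Idx (outVal a s o′)) →
             Σ (Idx (lam s)) λ j → Σ (OutAt a (elt (lam s) j)) λ o →
               outVal a (elt (lam s) j) o ≈ elt (outVal a s o′) k
  lam-out⁻ a (out b S′) o k = k , o , ≈-refl

  lam-bodies-supported : ∀ W (s : FC (Sub p Carrier)) →
                         (∀ bs n → Supported (_∈ binder s bs ∷ W) (elt (body s bs) n)) →
                         ∀ k → Supported (_∈ boundName (lam s) k ∷ W) (boundBody (lam s) k)
  lam-bodies-supported W (bnd b S′) h (j , _) = h _ j

  ufs-body : (s : FC (Sub p Carrier)) (bs : IsBnd s) → WF-F (UFS A) s → UFS A (body s bs)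
  ufs-body (bnd b S′) _ u = u

  body-concretion-supported : ∀ d L → d ∉ L → (s : FC (Sub p Carrier)) →
                              (∀ bs n → Supported (_∈ binder s bs ∷ L) (elt (body s bs) n)) →
                              ∀ bs n → Supported (_∈ d ∷ L) (elt (concAt TA d s bs) n)
  body-concretion-supported d L d∉L (bnd b S′) h bs n = concretion-supported b d L L (h bs n) (h bs n) d∉L

  module Concretions (dL dR e : Name) (LL LR : List Name)
                     (dL∉LL : dL ∉ LL) (dR∉LR : dR ∉ LR) (e∉LL : e ∉ LL) (e∉LR : e ∉ LR) where

    lam-concretion : (s : FC (Sub p Carrier)) →
                     (∀ k → Supported (_∈ boundName (lam s) k ∷ LL) (boundBody (lam s) k)) →
                     (∀ bs n → Supported (_∈ binder s bs ∷ LR) (elt (body s bs) n)) →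
                     ∀ j bs → Σ (IsBnd s) λ bs′ → Σ (Idx (concAt TA dR s bs′)) λ n →
                       act (tr dR e) (elt (concAt TA dR s bs′) n)
                         ≈ act (tr dL e) (concAt A dL (elt (lam s) j) bs)
    lam-concretion (bnd b S′) hL hR j bs =
      _ , j , concretions-agree b dR dL e LR LL (hR _ j) (hL (j , bs)) dR∉LR dL∉LL e∉LR e∉LL

    lam-concretion⁻ : (s : FC (Sub p Carrier)) →
                      (∀ k → Supported (_∈ boundName (lam s) k ∷ LL) (boundBody (lam s) k)) →
                      (∀ bs n → Supported (_∈ binder s bs ∷ LR) (elt (body s bs) n)) →
                      ∀ bs′ n → Σ (Idx (lam s)) λ j → Σ (IsBnd (elt (lam s) j)) λ bs →
                        act (tr dL e) (concAt A dL (elt (lam s) j) bs)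
                          ≈ act (tr dR e) (elt (concAt TA dR s bs′) n)
    lam-concretion⁻ (bnd b S′) hL hR bs′ n =
      n , _ , concretions-agree b dL dR e LL LR (hL (n , _)) (hR bs′ n) dL∉LL dR∉LR e∉LL e∉LR

  extLaw1 : ExtLaw1 p X
  extLaw1 S ((U , uS) , wf) bL bR dL dR (bL⇔ , (LL , sM , dL∉LL)) (bR⇔ , (LR , sS , dR∉LR)) =
    flags , outputs , abstraction
    where
    M : Sub p (FC Carrier)
    M = mu (Tmap lam S)

    lhs rhs : NomStr.Carrier (𝔾 TA)
    lhs = epsilon p A bL dL M
    rhs = Gmap mu (epsilon p TA bR dR S)

    flags : bL ≡ bR
    flags = ≡-from-true⇔ bL⇔ bR⇔ (λ ((i , j) , r) → i , lam-stop (elt S i) j r)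
                                 (λ (i , r) → let (j , r′) = lam-stop⁻ (elt S i) r in (i , j) , r′)

    outputs : NomStr._≈_ (Exp TA) (proj₁ (proj₂ lhs)) (proj₁ (proj₂ rhs))
    outputs a =
        (λ ((i , j) , o) → let (o′ , k , eq) = lam-out a (elt S i) j o in ((i , o′) , k) , eq)
      , (λ ((i , o′) , k) → let (j , o , eq) = lam-out⁻ a (elt S i) o′ k in ((i , j) , o) , eq)

    body-elements-supported : ∀ W → (∀ k → T.Supported (_∈ boundName S k ∷ W) (boundBody S k)) →
                              ∀ k n → Supported (_∈ boundName S k ∷ W) (elt (boundBody S k) n)
    body-elements-supported W s (i , bs) =
      elements-supported (boundBody S (i , bs)) _ (s (i , bs)) (ufs-body (elt S i) bs (wf i))

    S-elements-by-U : ∀ k n → Supported (_∈ boundName S k ∷ U) (elt (boundBody S k) n)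
    S-elements-by-U = body-elements-supported U (λ (i , bs) → T.bound-body-supported (elt S i) bs (uS i))

    S-elements-by-LR : ∀ k n → Supported (_∈ boundName S k ∷ LR) (elt (boundBody S k) n)
    S-elements-by-LR = body-elements-supported LR (T.ufs-bound-bodies-supported S LR sS (U , uS))

    M-bodies-by-LL : ∀ k → Supported (_∈ boundName M k ∷ LL) (boundBody M k)
    M-bodies-by-LL = bound-bodies-supported M LL sM U λ ((i , j) , bs) →
      lam-bodies-supported U (elt S i) (λ bs′ → S-elements-by-U (i , bs′)) (j , bs)

    left right : Sub p Carrier
    left = proj₂ (proj₂ (proj₂ lhs))
    right = proj₂ (proj₂ (proj₂ rhs))

    left-supported : Supports TA (dL ∷ LL) left
    left-supported = set-supported left (dL ∷ LL) λ ((i , j) , bs) →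
      concAt-supported dL (elt (lam (elt S i)) j) bs LL LL (M-bodies-by-LL _) (M-bodies-by-LL _) dL∉LL

    right-supported : Supports TA (dR ∷ LR) right
    right-supported = set-supported right (dR ∷ LR) λ ((i , bs) , n) →
      body-concretion-supported dR LR dR∉LR (elt S i) (λ bs′ → S-elements-by-LR (i , bs′)) bs n

    swapped-agree : ∀ e → e ∉ LL → e ∉ LR →
                    NomStr._≈_ TA (NomStr.act TA (tr dL e) left) (NomStr.act TA (tr dR e) right)
    swapped-agree e e∉LL e∉LR =
        (λ ((i , j) , bs) → let (bs′ , n , eq) = lam-concretion (elt S i) (hL i) (hR i) j bs
                            in ((i , bs′) , n) , eq)
      , (λ ((i , bs′) , n) → let (j , bs , eq) = lam-concretion⁻ (elt S i) (hL i) (hR i) bs′ n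
                             in ((i , j) , bs) , eq)
      where
      open Concretions dL dR e LL LR dL∉LL dR∉LR e∉LL e∉LR
      hL : ∀ i (k : Bound (lam (elt S i))) →
           Supported (_∈ boundName (lam (elt S i)) k ∷ LL) (boundBody (lam (elt S i)) k)
      hL i (j , bs) = M-bodies-by-LL ((i , j) , bs)
      hR : ∀ i bs n → Supported (_∈ binder (elt S i) bs ∷ LR) (elt (body (elt S i) bs) n)
      hR i bs = S-elements-by-LR (i , bs)

    abstraction : NomStr._≈_ (Abs TA) (proj₂ (proj₂ lhs)) (proj₂ (proj₂ rhs))
    abstraction = T.absEq-intro LL LR left-supported right-supported swapped-agree

module ExtensionLaw2 {c ℓ} (p : Level) (X : Nominal c ℓ) where
  private
    A : NomStr c ℓ
    A = Nominal.str X
    TA : NomStr (lsuc p ⊔ c) (p ⊔ ℓ)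
    TA = 𝕋 p A
    isPA : IsPermAction A
    isPA = isPermAction X
  open NomStr A
  open Support A isPA
  open BoundSupport A isPA
  module T = Support TA (𝕋-isPermAction p A isPA)

  extLaw2 : ExtLaw2 p X
  extLaw2 S ((U , uS) , uI) bL dL (bL⇔ , (LL , sM , dL∉LL)) β δ εspec bM dM (bM⇔ , (LM , sR , dM∉LM)) =
    flags , outputs , abstraction
    where
    M : Sub p (FC Carrier)
    M = mu S

    lhs rhs : NomStr.Carrier (𝔾 TA)
    lhs = epsilon p A bL dL M
    rhs = Gmap mu (rho p TA bM dM (Teps p A S β δ))

    L : Idx S → List Name
    L i = proj₁ (proj₂ (εspec i))

    δ∉L : ∀ i → δ i ∉ L i
    δ∉L i = proj₂ (proj₂ (proj₂ (εspec i)))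

    flags : bL ≡ bM
    flags = ≡-from-true⇔ bL⇔ bM⇔
      (λ ((i , j) , r) → i , Equivalence.from (proj₁ (εspec i)) (j , r))
      (λ (i , βi) → let (j , r) = Equivalence.to (proj₁ (εspec i)) βi in (i , j) , r)

    outputs : NomStr._≈_ (Exp TA) (proj₁ (proj₂ lhs)) (proj₁ (proj₂ rhs))
    outputs a = (λ ((i , j) , o) → (i , (j , o)) , ≈-refl) , (λ (i , (j , o)) → ((i , j) , o) , ≈-refl)

    bodies-by-U : ∀ i k → Supported (_∈ boundName (elt S i) k ∷ U) (boundBody (elt S i) k)
    bodies-by-U i = ufs-bound-bodies-supported (elt S i) U (uS i) (uI i)

    bodies-by-L : ∀ i k → Supported (_∈ boundName (elt S i) k ∷ L i) (boundBody (elt S i) k)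
    bodies-by-L i = ufs-bound-bodies-supported (elt S i) (L i) (proj₁ (proj₂ (proj₂ (εspec i)))) (uI i)

    M-bodies-by-LL : ∀ k → Supported (_∈ boundName M k ∷ LL) (boundBody M k)
    M-bodies-by-LL = bound-bodies-supported M LL sM U (λ ((i , j) , bs) → bodies-by-U i (j , bs))

    C : Idx S → Sub p Carrier
    C i = fam (Bound (elt S i)) (λ (j , bs) → concAt A (δ i) (elt (elt S i) j) bs)

    C-elements-by-U : ∀ i k → Supported (_∈ δ i ∷ U) (elt (C i) k)
    C-elements-by-U i (j , bs) = concAt-supported (δ i) (elt (elt S i) j) bs U (L i)
                                   (bodies-by-U i (j , bs)) (bodies-by-L i (j , bs)) (δ∉L i)

    C-by-LM : ∀ i → T.Supported (_∈ δ i ∷ LM) (C i)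
    C-by-LM = T.binder-family-supported LM δ C
      (λ π fix i → let (j , _ , _ , C≈) = proj₁ (sR π fix) i in j , C≈) U
      (λ i → set-supported (C i) (δ i ∷ U) (C-elements-by-U i))

    C-elements-by-LM : ∀ i k → Supported (_∈ δ i ∷ LM) (elt (C i) k)
    C-elements-by-LM i = elements-supported (C i) (δ i ∷ LM) (C-by-LM i) (δ i ∷ U , C-elements-by-U i)

    left right : Sub p Carrier
    left = proj₂ (proj₂ (proj₂ lhs))
    right = proj₂ (proj₂ (proj₂ rhs))

    left-supported : Supports TA (dL ∷ LL) left
    left-supported = set-supported left (dL ∷ LL) λ ((i , j) , bs) →
      concAt-supported dL (elt (elt S i) j) bs LL LL (M-bodies-by-LL _) (M-bodies-by-LL _) dL∉LL

    right-supported : Supports TA (dM ∷ LM) right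
    right-supported = set-supported right (dM ∷ LM) λ (i , k) →
      concretion-supported (δ i) dM LM LM (C-elements-by-LM i k) (C-elements-by-LM i k) dM∉LM

    elements-agree : ∀ e → e ∉ LL → e ∉ LM → ∀ i j bs →
                     act (tr dM e) (act (tr (δ i) dM) (elt (C i) (j , bs)))
                       ≈ act (tr dL e) (concAt A dL (elt (elt S i) j) bs)
    elements-agree e e∉LL e∉LM i j bs = begin
        act (tr dM e) (act (tr (δ i) dM) (concAt A (δ i) s bs))
      ≈⟨ concretion-swap (δ i) dM e LM LM y-by-LM y-by-LM dM∉LM e∉LM ⟩
        act (tr (δ i) e) (concAt A (δ i) s bs)
      ≈⟨ concAt-swap (δ i) e s bs LL (L i) x-by-LL (bodies-by-L i (j , bs)) (δ∉L i) e∉LL ⟩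
        act (tr (binder s bs) e) (body s bs)
      ≈⟨ concAt-swap dL e s bs LL LL x-by-LL x-by-LL dL∉LL e∉LL ⟨
        act (tr dL e) (concAt A dL s bs)
      ∎
      where
      open import Relation.Binary.Reasoning.Setoid ≈-setoid
      s : FC Carrier
      s = elt (elt S i) j
      y-by-LM : Supported (_∈ δ i ∷ LM) (concAt A (δ i) s bs)
      y-by-LM = C-elements-by-LM i (j , bs)
      x-by-LL : Supported (_∈ binder s bs ∷ LL) (body s bs)
      x-by-LL = M-bodies-by-LL ((i , j) , bs)

    swapped-agree : ∀ e → e ∉ LL → e ∉ LM →
                    NomStr._≈_ TA (NomStr.act TA (tr dL e) left) (NomStr.act TA (tr dM e) right)
    swapped-agree e e∉LL e∉LM =
        (λ ((i , j) , bs) → (i , (j , bs)) , elements-agree e e∉LL e∉LM i j bs)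
      , (λ (i , (j , bs)) → ((i , j) , bs) , sym (elements-agree e e∉LL e∉LM i j bs))

    abstraction : NomStr._≈_ (Abs TA) (proj₂ (proj₂ lhs)) (proj₂ (proj₂ rhs))
    abstraction = T.absEq-intro LL LM left-supported right-supported swapped-agree

mainTheorem18 : ∀ {c ℓ} (p : Level) (X : Nominal c ℓ) → ExtLaw1 p X × ExtLaw2 p X
mainTheorem18 p X = ExtensionLaw1.extLaw1 p X , ExtensionLaw2.extLaw2 p X
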